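{- Let $b\ge 2$ and $k\ge 1$ be integers, and let $\alpha(b,k):=\lfloor\vartheta(b)b^k\rfloor-Z_b(b^k)$. Then $\alpha(b,k)\ge 0$ and the number $\eta(b,k)$ of digits of the base-$b$ expansion of $\alpha(b,k)$ satisfies $$\eta(b,k)\le\lfloor\log_b k+2\rfloor.$$
   Context: $Z_b(m)$ is the number of trailing zeroes in the base-$b$ expansion of $m!$, i.e. the largest $e\ge0$ with $b^e\mid m!$. $\vartheta(b):=\lim_{m\to\infty}Z_b(m)/m$, which equals $\min_i \frac{1}{r_i(p_i-1)}$ when $b=p_1^{r_1}\cdots p_s^{r_s}$. For an integer $\alpha\ge1$, its number of base-$b$ digits is $\eta=\lfloor\log_b\alpha+1\rfloor$; for $\alpha=0$ we set $\eta=0$. -}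

module Defs where

open import Data.Nat using (ℕ; zero; suc; _+_; _*_; _∸_; _^_; _≤_; _<_; NonZero; _!)
open import Data.Nat.Divisibility using (_∣_; _∣?_)
open import Data.Nat.Primality using (prime?)
open import Data.Nat.Properties using (_≤?_; _<?_)
open import Data.Integer as ℤ using (ℤ; +_)
open import Data.Rational as ℚ using (ℚ; floor; _⊓_)
open import Data.List using (List; []; _∷_; filter; map; upTo)
open import Relation.Nullary using (yes; no)
open import Relation.Nullary.Decidable using (_×-dec_)

largestPowDiv : ℕ → ℕ → ℕ → ℕ
largestPowDiv b n zero = zero
largestPowDiv b n (suc N) with (b ^ suc N) ∣? n
... | yes _ = suc N
... | no _ = largestPowDiv b n N

-- Z_b(m): the largest e with b^e ∣ m!.  The search bound m! suffices:
-- for b ≥ 2, b^e ∣ m! and m! > 0 give e < 2^e ≤ b^e ≤ m!.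
Z : ℕ → ℕ → ℕ
Z b m = largestPowDiv b (m !) (m !)

-- v_p(b): exponent of p in b (search bound b suffices for p ≥ 2, b ≥ 1)
val : ℕ → ℕ → ℕ
val p b = largestPowDiv p b b

primeDivisors : ℕ → List ℕ
primeDivisors b = filter (λ p → prime? p ×-dec (p ∣? b)) (upTo (suc b))

-- minimum of a list of rationals (0 on the empty list; unused for b ≥ 2)
minList : List ℚ → ℚ
minList [] = ℚ.0ℚ
minList (x ∷ []) = x
minList (x ∷ y ∷ xs) = x ⊓ minList (y ∷ xs)

-- the term 1 / (r (p - 1)); denominators 0 (impossible for p prime dividing b) mapped to 0
invTerm : ℕ → ℕ → ℚ
invTerm p r with r * (p ∸ 1)
... | zero = ℚ.0ℚ
... | suc d = (+ 1) ℚ./ suc d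

ϑ : ℕ → ℚ
ϑ b = minList (map (λ p → invTerm p (val p b)) (primeDivisors b))

α : ℕ → ℕ → ℤ
α b k = floor (ϑ b ℚ.* ((+ (b ^ k)) ℚ./ 1)) ℤ.- (+ Z b (b ^ k))

-- ⌊log_b n⌋ for n ≥ 1: the largest e ≤ n with b^e ≤ n (bound n suffices as b^e > e for b ≥ 2)
floorLogAux : ℕ → ℕ → ℕ → ℕ
floorLogAux b n zero = zero
floorLogAux b n (suc N) with (b ^ suc N) ≤? n
... | yes _ = suc N
... | no _ = floorLogAux b n N

floorLog : ℕ → ℕ → ℕ
floorLog b n = floorLogAux b n n

numDigits : ℕ → ℕ → ℕ
numDigits b zero = zero
numDigits b (suc a) = floorLog b (suc a) + 1

{-# OPTIONS --safe #-}
-- Write m = b^k and, for a prime p with p^r ∥ b, call r (p − 1) the weight of p, so that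
-- ϑ(b) is the reciprocal of the largest weight W.  Legendre's recursion
-- v_p(m!) = ⌊m/p⌋ + v_p(⌊m/p⌋!) gives (p − 1) v_p(m!) ≤ m ≤ (p − 1) (v_p(m!) + D) whenever
-- m < p^D.  The first bound shows Z_b(m) W ≤ m, i.e. Z_b(m) ≤ f := ⌊m/W⌋ = ⌊ϑ(b) m⌋.  The
-- second, with D = bk, shows v_p(b^(f − bk)) ≤ v_p(m!) for every prime p, hence b^(f − bk) ∣ m!
-- and f − bk ≤ Z_b(m).  So 0 ≤ α(b,k) ≤ bk, and bk has at most ⌊log_b k⌋ + 2 digits.

module Submission where

open import Defs
open import Data.Nat
open import Data.Nat.Properties
open import Data.Nat.Divisibility
open import Data.Nat.DivMod using (m≡m%n+[m/n]*n; m%n<n; m*n/n≡m; /-mono-≤; m/n*n≤m; m*n/m*o≡n/o; m*n/o*n≡m/o; m<n*o⇒m/o<n)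
open import Data.Nat.Induction using (<-rec)
open import Data.Nat.Primality using (Prime; euclidsLemma; prime⇒nonZero; prime⇒nonTrivial; prime?)
open import Data.Nat.Primality.Factorisation using (factorise)
open import Data.Nat.Tactic.RingSolver using (solve-∀)
open import Data.Product using (_×_; _,_; proj₂; map₂; ∃-syntax)
open import Data.Sum using (inj₁; inj₂)
open import Data.Empty using (⊥-elim)
open import Function.Base using (it)
open import Data.List using ([]; _∷_; upTo)
open import Data.List.Membership.Propositional using (_∈_)
open import Data.List.Membership.Propositional.Properties using (∈-map⁺; ∈-map⁻; ∈-filter⁺; ∈-filter⁻; ∈-upTo⁺)
open import Data.List.Relation.Unary.Any using (here; there)
open import Data.Nat.ListAction using (product)
open import Data.List.Relation.Unary.All using (_∷_)
open import Relation.Nullary using (¬_; yes; no)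
open import Relation.Nullary.Decidable using (_×-dec_)
open import Relation.Binary.PropositionalEquality
open import Data.Integer as ℤ using (+_; -[1+_]; ∣_∣)
import Data.Integer.Properties as ℤP
open import Data.Integer.DivMod using (div-pos-is-/ℕ)
open import Data.Integer.GCD using (gcd)
open import Data.Rational as ℚ using (ℚ; mkℚ; floor; toℚᵘ; ↥_; ↧_)
import Data.Rational.Properties as ℚP
open import Data.Rational.Unnormalised as ℚᵘ using (mkℚᵘ; *≡*; *≤*)
import Data.Rational.Unnormalised.Properties as ℚᵘP
open import Algebra.Properties.CommutativeSemigroup ℤP.*-commutativeSemigroup using (x∙yz≈xz∙y)

largestPowDiv-∣ : ∀ b n N → b ^ largestPowDiv b n N ∣ n
largestPowDiv-∣ b n zero = 1∣ n
largestPowDiv-∣ b n (suc N) with b ^ suc N ∣? n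
... | yes b^N+1∣n = b^N+1∣n
... | no _ = largestPowDiv-∣ b n N

largestPowDiv-maximal : ∀ b n N {j} → j ≤ N → b ^ j ∣ n → j ≤ largestPowDiv b n N
largestPowDiv-maximal b n zero j≤0 _ = j≤0
largestPowDiv-maximal b n (suc N) j≤N+1 b^j∣n with b ^ suc N ∣? n
... | yes _ = j≤N+1
... | no b^N+1∤n with m≤n⇒m<n∨m≡n j≤N+1
...   | inj₁ j≤N = largestPowDiv-maximal b n N (≤-pred j≤N) b^j∣n
...   | inj₂ refl = ⊥-elim (b^N+1∤n b^j∣n)

floorLogAux-≤ : ∀ b n N → 1 ≤ n → b ^ floorLogAux b n N ≤ n
floorLogAux-≤ b n zero 1≤n = 1≤n
floorLogAux-≤ b n (suc N) 1≤n with b ^ suc N ≤? n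
... | yes b^N+1≤n = b^N+1≤n
... | no _ = floorLogAux-≤ b n N 1≤n

floorLogAux-maximal : ∀ b n N {j} → j ≤ N → b ^ j ≤ n → j ≤ floorLogAux b n N
floorLogAux-maximal b n zero j≤0 _ = j≤0
floorLogAux-maximal b n (suc N) j≤N+1 b^j≤n with b ^ suc N ≤? n
... | yes _ = j≤N+1
... | no b^N+1≰n with m≤n⇒m<n∨m≡n j≤N+1
...   | inj₁ j≤N = floorLogAux-maximal b n N (≤-pred j≤N) b^j≤n
...   | inj₂ refl = ⊥-elim (b^N+1≰n b^j≤n)

n<2^n : ∀ n → n < 2 ^ n
n<2^n zero = s≤s z≤n
n<2^n (suc n) = begin-strict
  suc n           ≤⟨ n<2^n n ⟩
  2 ^ n           <⟨ m<m+n (2 ^ n) (m^n>0 2 n) ⟩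
  2 ^ n + 2 ^ n   ≡⟨ cong (_+_ (2 ^ n)) (sym (+-identityʳ (2 ^ n))) ⟩
  2 ^ suc n       ∎
  where open ≤-Reasoning

n<b^n : ∀ {b} → 2 ≤ b → ∀ n → n < b ^ n
n<b^n 2≤b n = ≤-trans (n<2^n n) (^-monoˡ-≤ n 2≤b)

b^k<2^[b*k] : ∀ b k .{{_ : NonZero k}} → b ^ k < 2 ^ (b * k)
b^k<2^[b*k] b k = subst (b ^ k <_) (^-*-assoc 2 b k) (^-monoˡ-< k (n<2^n b))

^∣⇒≤ : ∀ {b n j} .{{_ : NonZero n}} → 2 ≤ b → b ^ j ∣ n → j ≤ n
^∣⇒≤ {j = j} 2≤b b^j∣n = <⇒≤ (≤-trans (n<b^n 2≤b j) (∣⇒≤ b^j∣n))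

^≤⇒≤ : ∀ {b n j} → 2 ≤ b → b ^ j ≤ n → j ≤ n
^≤⇒≤ {j = j} 2≤b b^j≤n = <⇒≤ (<-≤-trans (n<b^n 2≤b j) b^j≤n)

^-monoʳ-∣ : ∀ p {i j} → i ≤ j → p ^ i ∣ p ^ j
^-monoʳ-∣ p {i} {j} i≤j = divides (p ^ (j ∸ i)) (begin
  p ^ j              ≡⟨ cong (p ^_) (sym (m∸n+n≡m i≤j)) ⟩
  p ^ (j ∸ i + i)    ≡⟨ ^-distribˡ-+-* p (j ∸ i) i ⟩
  p ^ (j ∸ i) * p ^ i ∎)
  where open ≡-Reasoning

^-monoˡ-∣ : ∀ {a c} n → a ∣ c → a ^ n ∣ c ^ n
^-monoˡ-∣ zero _ = ∣-refl
^-monoˡ-∣ (suc n) a∣c = *-pres-∣ a∣c (^-monoˡ-∣ n a∣c)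

val-∣ : ∀ p n → p ^ val p n ∣ n
val-∣ p n = largestPowDiv-∣ p n n

val-maximal : ∀ {p n j} .{{_ : NonZero n}} → 2 ≤ p → p ^ j ∣ n → j ≤ val p n
val-maximal {p} {n} 2≤p p^j∣n = largestPowDiv-maximal p n n (^∣⇒≤ 2≤p p^j∣n) p^j∣n

val-exact : ∀ {p n} .{{_ : NonZero n}} → 2 ≤ p → ¬ p ^ suc (val p n) ∣ n
val-exact 2≤p p^v+1∣n = 1+n≰n (val-maximal 2≤p p^v+1∣n)

val-unique : ∀ {p n e} .{{_ : NonZero n}} → 2 ≤ p → p ^ e ∣ n → ¬ p ^ suc e ∣ n → val p n ≡ e
val-unique {p} {n} {e} 2≤p p^e∣n p^e+1∤n with val p n ≤? e
... | yes v≤e = ≤-antisym v≤e (val-maximal 2≤p p^e∣n)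
... | no v≰e = ⊥-elim (p^e+1∤n (∣-trans (^-monoʳ-∣ p (≰⇒> v≰e)) (val-∣ p n)))

Z-∣ : ∀ b m → b ^ Z b m ∣ m !
Z-∣ b m = largestPowDiv-∣ b (m !) (m !)

Z-maximal : ∀ {b m j} → 2 ≤ b → b ^ j ∣ m ! → j ≤ Z b m
Z-maximal {b} {m} 2≤b b^j∣m! = largestPowDiv-maximal b (m !) (m !) (^∣⇒≤ {{m !≢0}} 2≤b b^j∣m!) b^j∣m!

floorLog-≤ : ∀ b {n} → 1 ≤ n → b ^ floorLog b n ≤ n
floorLog-≤ b {n} = floorLogAux-≤ b n n

floorLog-maximal : ∀ {b n j} → 2 ≤ b → b ^ j ≤ n → j ≤ floorLog b n
floorLog-maximal {b} {n} 2≤b b^j≤n = floorLogAux-maximal b n n (^≤⇒≤ 2≤b b^j≤n) b^j≤n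

2≤⇒nonZero : ∀ {n} → 2 ≤ n → NonZero n
2≤⇒nonZero 2≤n = >-nonZero (<-trans z<s 2≤n)

prime⇒2≤ : ∀ {p} → Prime p → 2 ≤ p
prime⇒2≤ {p} p-prime = nonTrivial⇒n>1 p {{prime⇒nonTrivial p-prime}}

val-≡0 : ∀ {p n} .{{_ : NonZero n}} → 2 ≤ p → ¬ p ∣ n → val p n ≡ 0
val-≡0 {p} {n} 2≤p p∤n = val-unique 2≤p (1∣ n) (λ p^1∣n → p∤n (subst (_∣ n) (*-identityʳ p) p^1∣n))

val-1 : ∀ {p} → 2 ≤ p → val p 1 ≡ 0
val-1 2≤p = val-≡0 2≤p (λ p∣1 → <⇒≱ 2≤p (∣⇒≤ p∣1))

val-self : ∀ {p} → 2 ≤ p → val p p ≡ 1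
val-self {p} 2≤p = val-unique 2≤p (subst (_∣ p) (sym (*-identityʳ p)) ∣-refl) p²∤p
  where
  instance nonZero-p : NonZero p
  nonZero-p = 2≤⇒nonZero 2≤p
  p²∤p : ¬ p ^ 2 ∣ p
  p²∤p p²∣p = <⇒≱ (subst (p <_) (cong (p *_) (sym (*-identityʳ p))) (m<m*n p p 2≤p)) (∣⇒≤ p²∣p)

val-≥1 : ∀ {p n} .{{_ : NonZero n}} → 2 ≤ p → p ∣ n → 1 ≤ val p n
val-≥1 {p} {n} 2≤p p∣n = val-maximal 2≤p (subst (_∣ n) (sym (*-identityʳ p)) p∣n)

val-cofactor : ∀ {p n} .{{_ : NonZero n}} → 2 ≤ p → ∃[ u ] n ≡ u * p ^ val p n × ¬ p ∣ u
val-cofactor {p} {n} 2≤p with val-∣ p n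
... | divides u n≡u*p^v = u , n≡u*p^v , p∤u
  where
  p∤u : ¬ p ∣ u
  p∤u (divides w u≡w*p) = val-exact 2≤p (divides w (begin
    n                      ≡⟨ n≡u*p^v ⟩
    u * p ^ val p n        ≡⟨ cong (_* p ^ val p n) u≡w*p ⟩
    w * p * p ^ val p n    ≡⟨ *-assoc w p (p ^ val p n) ⟩
    w * p ^ suc (val p n)  ∎))
    where open ≡-Reasoning

val-* : ∀ {p} x y .{{_ : NonZero x}} .{{_ : NonZero y}} → Prime p →
        val p (x * y) ≡ val p x + val p y
val-* {p} x y p-prime with val-cofactor {n = x} (prime⇒2≤ p-prime) | val-cofactor {n = y} (prime⇒2≤ p-prime)
... | u , x≡u*p^a , p∤u | v , y≡v*p^b , p∤v =
  val-unique {{m*n≢0 x y}} 2≤p p^a+b∣xy p^a+b+1∤xy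
  where
  2≤p = prime⇒2≤ p-prime
  a = val p x
  b = val p y
  instance nonZero-p^a+b : NonZero (p ^ (a + b))
  nonZero-p^a+b = m^n≢0 p (a + b) {{2≤⇒nonZero 2≤p}}
  xy≡p^a+b*uv : x * y ≡ p ^ (a + b) * (u * v)
  xy≡p^a+b*uv = begin
    x * y                          ≡⟨ cong₂ _*_ x≡u*p^a y≡v*p^b ⟩
    (u * p ^ a) * (v * p ^ b)      ≡⟨ rearrange u v (p ^ a) (p ^ b) ⟩
    (p ^ a * p ^ b) * (u * v)      ≡⟨ cong (_* (u * v)) (^-distribˡ-+-* p a b) ⟨
    p ^ (a + b) * (u * v)          ∎
    where
    open ≡-Reasoning
    rearrange : ∀ u v s t → (u * s) * (v * t) ≡ (s * t) * (u * v)
    rearrange = solve-∀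
  p^a+b∣xy : p ^ (a + b) ∣ x * y
  p^a+b∣xy = subst (_∣ x * y) (sym (^-distribˡ-+-* p a b)) (*-pres-∣ (val-∣ p x) (val-∣ p y))
  p^a+b+1∤xy : ¬ p ^ suc (a + b) ∣ x * y
  p^a+b+1∤xy p^a+b+1∣xy with euclidsLemma u v p-prime
       (*-cancelˡ-∣ (p ^ (a + b)) (subst₂ _∣_ (*-comm p (p ^ (a + b))) xy≡p^a+b*uv p^a+b+1∣xy))
  ... | inj₁ p∣u = p∤u p∣u
  ... | inj₂ p∣v = p∤v p∣v

val-^ : ∀ {p} b E .{{_ : NonZero b}} → Prime p → val p (b ^ E) ≡ E * val p b
val-^ b zero p-prime = val-1 (prime⇒2≤ p-prime)
val-^ {p} b (suc E) p-prime = begin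
  val p (b * b ^ E)          ≡⟨ val-* b (b ^ E) p-prime ⟩
  val p b + val p (b ^ E)    ≡⟨ cong (_+_ (val p b)) (val-^ b E p-prime) ⟩
  val p b + E * val p b      ∎
  where
  open ≡-Reasoning
  instance nonZero-b^E : NonZero (b ^ E)
  nonZero-b^E = m^n≢0 b E

∃-prime-∣ : ∀ {n} → 2 ≤ n → ∃[ p ] Prime p × p ∣ n
∃-prime-∣ {suc zero} (s≤s ())
∃-prime-∣ {n@(suc (suc _))} _ with factorise n
... | record { factors = p ∷ ps ; isFactorisation = n≡p*∏ps ; factorsPrime = p-prime ∷ _ } =
  p , p-prime , subst (p ∣_) (sym n≡p*∏ps) (m∣m*n (product ps))

val-≤⇒∣ : ∀ d n .{{_ : NonZero d}} .{{_ : NonZero n}} →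
          (∀ {p} → Prime p → val p d ≤ val p n) → d ∣ n
val-≤⇒∣ = <-rec ValDivides step
  where
  ValDivides : ℕ → Set
  ValDivides d = ∀ n .{{_ : NonZero d}} .{{_ : NonZero n}} →
                 (∀ {p} → Prime p → val p d ≤ val p n) → d ∣ n
  step : ∀ d → (∀ {e} → e < d → ValDivides e) → ValDivides d
  step zero _ _ = ⊥-elim (≢-nonZero⁻¹ 0 refl)
  step (suc zero) _ n _ = 1∣ n
  step d@(suc (suc _)) rec n val-d≤val-n with ∃-prime-∣ {d} (s≤s (s≤s z≤n))
  ... | p , p-prime , p∣d@(divides e d≡e*p) =
    subst₂ _∣_ (sym d≡e*p) (sym n≡f*p) (*-monoˡ-∣ p (rec e<d f val-e≤val-f))
    where
    2≤p = prime⇒2≤ p-prime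
    p∣n : p ∣ n
    p∣n = subst (_∣ n) (*-identityʳ p)
            (∣-trans (^-monoʳ-∣ p (≤-trans (val-≥1 2≤p p∣d) (val-d≤val-n p-prime))) (val-∣ p n))
    f = quotient p∣n
    n≡f*p : n ≡ f * p
    n≡f*p = _∣_.equality p∣n
    instance
      nonZero-e : NonZero e
      nonZero-e = m*n≢0⇒m≢0 e {{subst NonZero d≡e*p it}}
      nonZero-f : NonZero f
      nonZero-f = m*n≢0⇒m≢0 f {{subst NonZero n≡f*p it}}
      nonZero-p : NonZero p
      nonZero-p = prime⇒nonZero p-prime
    e<d : e < d
    e<d = subst (e <_) (sym d≡e*p) (m<m*n e p 2≤p)
    val-e≤val-f : ∀ {q} → Prime q → val q e ≤ val q f
    val-e≤val-f {q} q-prime = +-cancelʳ-≤ (val q p) (val q e) (val q f) (begin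
      val q e + val q p   ≡⟨ val-* e p q-prime ⟨
      val q (e * p)       ≡⟨ cong (val q) d≡e*p ⟨
      val q d             ≤⟨ val-d≤val-n q-prime ⟩
      val q n             ≡⟨ cong (val q) n≡f*p ⟩
      val q (f * p)       ≡⟨ val-* f p q-prime ⟩
      val q f + val q p   ∎)
      where open ≤-Reasoning

-- Legendre's formula, stated for p = c + 1 so that p − 1 is a variable and no truncated
-- subtraction enters the arithmetic.
module Legendre {c : ℕ} (p-prime : Prime (suc c)) where

  p : ℕ
  p = suc c

  val-!-suc : ∀ n → val p (suc n !) ≡ val p (suc n) + val p (n !)
  val-!-suc n = val-* (suc n) (n !) {{_}} {{n !≢0}} p-prime

  val-!-digit : ∀ t ρ → ρ < p → val p ((t * p + ρ) !) ≡ t + val p (t !)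
  val-!-digit zero zero _ = refl
  val-!-digit (suc t) zero _ = begin
    val p ((suc t * p + 0) !)               ≡⟨ cong (λ n → val p (n !)) (+-identityʳ (suc t * p)) ⟩
    val p (suc (c + t * p) !)               ≡⟨ val-!-suc (c + t * p) ⟩
    val p (suc t * p) + val p ((c + t * p) !)
      ≡⟨ cong₂ _+_ (val-* (suc t) p p-prime) (cong (λ n → val p (n !)) (+-comm c (t * p))) ⟩
    val p (suc t) + val p p + val p ((t * p + c) !)
      ≡⟨ cong₂ (λ v w → val p (suc t) + v + w) (val-self (prime⇒2≤ p-prime)) (val-!-digit t c ≤-refl) ⟩
    val p (suc t) + 1 + (t + val p (t !))   ≡⟨ regroup (val p (suc t)) t (val p (t !)) ⟩
    suc t + (val p (suc t) + val p (t !))   ≡⟨ cong (_+_ (suc t)) (val-!-suc t) ⟨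
    suc t + val p (suc t !)                 ∎
    where
    open ≡-Reasoning
    regroup : ∀ v t w → v + 1 + (t + w) ≡ suc t + (v + w)
    regroup = solve-∀
  val-!-digit t (suc ρ) 1+ρ<p = begin
    val p ((t * p + suc ρ) !)                         ≡⟨ cong (λ n → val p (n !)) (+-suc (t * p) ρ) ⟩
    val p (suc (t * p + ρ) !)                         ≡⟨ val-!-suc (t * p + ρ) ⟩
    val p (suc (t * p + ρ)) + val p ((t * p + ρ) !)   ≡⟨ cong₂ _+_ p∤-val≡0 (val-!-digit t ρ (<⇒≤ 1+ρ<p)) ⟩
    t + val p (t !)                                   ∎
    where
    open ≡-Reasoning
    p∤ : ¬ p ∣ suc (t * p + ρ)
    p∤ p∣ = <⇒≱ 1+ρ<p (∣⇒≤ (∣m+n∣m⇒∣n (subst (p ∣_) (sym (+-suc (t * p) ρ)) p∣) (n∣m*n t)))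
    p∤-val≡0 : val p (suc (t * p + ρ)) ≡ 0
    p∤-val≡0 = val-≡0 (prime⇒2≤ p-prime) p∤

  legendre : ∀ m → val p (m !) ≡ m / p + val p ((m / p) !)
  legendre m = begin
    val p (m !)                            ≡⟨ cong (λ n → val p (n !)) (m≡m%n+[m/n]*n m p) ⟩
    val p ((m % p + m / p * p) !)          ≡⟨ cong (λ n → val p (n !)) (+-comm (m % p) (m / p * p)) ⟩
    val p ((m / p * p + m % p) !)          ≡⟨ val-!-digit (m / p) (m % p) (m%n<n m p) ⟩
    m / p + val p ((m / p) !)              ∎
    where open ≡-Reasoning

  private
    /p-< : ∀ D m → m < p ^ suc D → m / p < p ^ D
    /p-< D m m<p^D+1 = m<n*o⇒m/o<n (subst (m <_) (*-comm p (p ^ D)) m<p^D+1)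

  val-!-upper-bounded : ∀ D m → m < p ^ D → c * val p (m !) ≤ m
  val-!-upper-bounded zero zero _ = ≤-reflexive (trans (cong (c *_) (val-1 (prime⇒2≤ p-prime))) (*-zeroʳ c))
  val-!-upper-bounded zero (suc m) (s≤s ())
  val-!-upper-bounded (suc D) m m<p^D+1 = begin
    c * val p (m !)            ≡⟨ cong (c *_) (legendre m) ⟩
    c * (t + val p (t !))      ≡⟨ *-distribˡ-+ c t (val p (t !)) ⟩
    c * t + c * val p (t !)    ≤⟨ +-monoʳ-≤ (c * t) (val-!-upper-bounded D t (/p-< D m m<p^D+1)) ⟩
    c * t + t                  ≡⟨ regroup c t ⟩
    t * p                      ≤⟨ m/n*n≤m m p ⟩
    m                          ∎
    where
    open ≤-Reasoning
    t = m / p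
    regroup : ∀ c t → c * t + t ≡ t * suc c
    regroup = solve-∀

  val-!-upper : ∀ m → c * val p (m !) ≤ m
  val-!-upper m = val-!-upper-bounded m m (n<b^n (prime⇒2≤ p-prime) m)

  val-!-lower : ∀ D m → m < p ^ D → m ≤ c * (val p (m !) + D)
  val-!-lower zero zero _ = z≤n
  val-!-lower zero (suc m) (s≤s ())
  val-!-lower (suc D) m m<p^D+1 = begin
    m                                    ≡⟨ m≡m%n+[m/n]*n m p ⟩
    m % p + t * p                        ≤⟨ +-monoˡ-≤ (t * p) (≤-pred (m%n<n m p)) ⟩
    c + t * p                            ≡⟨ regroup₁ c t ⟩
    c + c * t + t                        ≤⟨ +-monoʳ-≤ (c + c * t) (val-!-lower D t (/p-< D m m<p^D+1)) ⟩
    c + c * t + c * (val p (t !) + D)    ≡⟨ regroup₂ c t (val p (t !)) D ⟩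
    c * (t + val p (t !) + suc D)        ≡⟨ cong (λ v → c * (v + suc D)) (legendre m) ⟨
    c * (val p (m !) + suc D)            ∎
    where
    open ≤-Reasoning
    t = m / p
    regroup₁ : ∀ c t → c + t * suc c ≡ c + c * t + t
    regroup₁ = solve-∀
    regroup₂ : ∀ c t v D → c + c * t + c * (v + D) ≡ c * (t + v + suc D)
    regroup₂ = solve-∀

prime⇒pred-nonZero : ∀ {p} → Prime p → NonZero (p ∸ 1)
prime⇒pred-nonZero p-prime with prime⇒2≤ p-prime
... | s≤s (s≤s _) = _

val-!-upper : ∀ {p} → Prime p → ∀ m → (p ∸ 1) * val p (m !) ≤ m
val-!-upper {zero} p-prime = ⊥-elim (≢-nonZero⁻¹ 0 {{prime⇒nonZero p-prime}} refl)
val-!-upper {suc _} p-prime = Legendre.val-!-upper p-prime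

val-!-lower : ∀ {p D m} → Prime p → m < p ^ D → m ≤ (p ∸ 1) * (val p (m !) + D)
val-!-lower {zero} p-prime = ⊥-elim (≢-nonZero⁻¹ 0 {{prime⇒nonZero p-prime}} refl)
val-!-lower {suc _} {D} {m} p-prime = Legendre.val-!-lower p-prime D m

weight : ℕ → ℕ → ℕ
weight b p = val p b * (p ∸ 1)

Z-upper : ∀ b m {p} → Prime p → Z b m * weight b p ≤ m
Z-upper b m {p} p-prime = begin
  Z b m * (r * c)      ≡⟨ regroup (Z b m) r c ⟩
  c * (r * Z b m)      ≤⟨ *-monoʳ-≤ c r*Z≤val ⟩
  c * val p (m !)      ≤⟨ val-!-upper p-prime m ⟩
  m                    ∎
  where
  open ≤-Reasoning
  r = val p b
  c = p ∸ 1
  regroup : ∀ z r c → z * (r * c) ≡ c * (r * z)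
  regroup = solve-∀
  p^rZ∣b^Z : p ^ (r * Z b m) ∣ b ^ Z b m
  p^rZ∣b^Z = subst (_∣ b ^ Z b m) (^-*-assoc p r (Z b m)) (^-monoˡ-∣ (Z b m) (val-∣ p b))
  r*Z≤val : r * Z b m ≤ val p (m !)
  r*Z≤val = val-maximal {{m !≢0}} (prime⇒2≤ p-prime) (∣-trans p^rZ∣b^Z (Z-∣ b m))

weight-cancel : ∀ E D r c v .{{_ : NonZero c}} → (E + D) * (r * c) ≤ c * (v + D) → E * r ≤ v
weight-cancel E D zero c v _ = subst (_≤ v) (sym (*-zeroʳ E)) z≤n
weight-cancel E D r@(suc _) c v ≤c[v+D] = *-cancelˡ-≤ c (+-cancelʳ-≤ (c * D) (c * (E * r)) (c * v) (begin
  c * (E * r) + c * D        ≤⟨ +-monoʳ-≤ (c * (E * r)) (*-monoʳ-≤ c (m≤m*n D r)) ⟩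
  c * (E * r) + c * (D * r)  ≡⟨ regroup c E D r ⟩
  (E + D) * (r * c)          ≤⟨ ≤c[v+D] ⟩
  c * (v + D)                ≡⟨ *-distribˡ-+ c v D ⟩
  c * v + c * D              ∎))
  where
  open ≤-Reasoning
  regroup : ∀ c E D r → c * (E * r) + c * (D * r) ≡ (E + D) * (r * c)
  regroup = solve-∀

Z-lower : ∀ {b m D f} → 2 ≤ b → m < 2 ^ D → (∀ {p} → Prime p → f * weight b p ≤ m) → f ≤ Z b m + D
Z-lower {b} {m} {D} {f} 2≤b m<2^D f*weight≤m with f ≤? D
... | yes f≤D = ≤-trans f≤D (m≤n+m D (Z b m))
... | no f≰D = begin
  f               ≡⟨ m∸n+n≡m D≤f ⟨
  E + D           ≤⟨ +-monoˡ-≤ D (Z-maximal {m = m} 2≤b (val-≤⇒∣ (b ^ E) (m !) {{m^n≢0 b E}} {{m !≢0}} val-b^E≤val-m!)) ⟩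
  Z b m + D       ∎
  where
  open ≤-Reasoning
  E = f ∸ D
  D≤f = <⇒≤ (≰⇒> f≰D)
  instance nonZero-b : NonZero b
  nonZero-b = 2≤⇒nonZero 2≤b
  val-b^E≤val-m! : ∀ {p} → Prime p → val p (b ^ E) ≤ val p (m !)
  val-b^E≤val-m! {p} p-prime = subst (_≤ val p (m !)) (sym (val-^ b E p-prime))
    (weight-cancel E D (val p b) (p ∸ 1) (val p (m !)) {{prime⇒pred-nonZero p-prime}} (begin
      (E + D) * weight b p          ≡⟨ cong (_* weight b p) (m∸n+n≡m D≤f) ⟩
      f * weight b p                ≤⟨ f*weight≤m p-prime ⟩
      m                             ≤⟨ val-!-lower p-prime (<-≤-trans m<2^D (^-monoˡ-≤ D (prime⇒2≤ p-prime))) ⟩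
      (p ∸ 1) * (val p (m !) + D)   ∎))

^≤b*⇒≤1+floorLog : ∀ {b k} L → 2 ≤ b → b ^ L ≤ b * k → L ≤ suc (floorLog b k)
^≤b*⇒≤1+floorLog zero _ _ = z≤n
^≤b*⇒≤1+floorLog {b} (suc e) 2≤b b^e+1≤b*k =
  s≤s (floorLog-maximal 2≤b (*-cancelˡ-≤ b {{2≤⇒nonZero 2≤b}} b^e+1≤b*k))

numDigits-≤ : ∀ {b k a} → 2 ≤ b → a ≤ b * k → numDigits b a ≤ floorLog b k + 2
numDigits-≤ {a = zero} _ _ = z≤n
numDigits-≤ {b} {k} {suc a} 2≤b a<b*k = begin
  floorLog b (suc a) + 1    ≤⟨ +-monoˡ-≤ 1 (^≤b*⇒≤1+floorLog _ 2≤b b^L≤b*k) ⟩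
  suc (floorLog b k) + 1    ≡⟨ +-suc (floorLog b k) 1 ⟨
  floorLog b k + 2          ∎
  where
  open ≤-Reasoning
  b^L≤b*k : b ^ floorLog b (suc a) ≤ b * k
  b^L≤b*k = ≤-trans (floorLog-≤ b (s≤s z≤n)) a<b*k

-- Rational floors

/-cross : ∀ a e n d → a * suc d ≡ n * suc e → a / suc e ≡ n / suc d
/-cross a e n d a*d≡n*e = begin
  a / suc e                      ≡⟨ m*n/o*n≡m/o a (suc d) (suc e) ⟨
  a * suc d / (suc e * suc d)    ≡⟨ cong (λ t → t / (suc e * suc d)) (trans a*d≡n*e (*-comm n (suc e))) ⟩
  suc e * n / (suc e * suc d)    ≡⟨ m*n/m*o≡n/o (suc e) n (suc d) ⟩
  n / suc d                      ∎
  where open ≡-Reasoning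

*≤⇒≤/ : ∀ {z d n} .{{_ : NonZero d}} → z * d ≤ n → z ≤ n / d
*≤⇒≤/ {z} {d} {n} z*d≤n = subst (_≤ n / d) (m*n/n≡m z d) (/-mono-≤ z*d≤n ≤-refl)

floor-≃ : ∀ x n d → toℚᵘ x ℚᵘ.≃ mkℚᵘ (+ n) d → floor x ≡ + (n / suc d)
floor-≃ (mkℚ (+ a) e _) n d (*≡* eq) =
  trans (div-pos-is-/ℕ (+ a) (suc e))
        (cong +_ (/-cross a e n d (ℤP.+-injective (trans (ℤP.pos-* a (suc d)) (trans eq (sym (ℤP.pos-* n (suc e))))))))
floor-≃ (mkℚ -[1+ a ] e _) n d (*≡* eq) = ⊥-elim (neg≢pos (trans eq (sym (ℤP.pos-* n (suc e)))))
  where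
  neg≢pos : -[1+ a ] ℤ.* + suc d ≢ + (n * suc e)
  neg≢pos ()

toℚᵘ-/ : ∀ i n → toℚᵘ (i ℚ./ suc n) ℚᵘ.≃ mkℚᵘ i n
toℚᵘ-/ i n = *≡* (begin
  ℚᵘ.↥ (toℚᵘ r) ℤ.* + suc n   ≡⟨ cong (ℤ._* + suc n) (ℚP.↥ᵘ-toℚᵘ r) ⟩
  ↥ r ℤ.* + suc n             ≡⟨ cong (↥ r ℤ.*_) (ℚP.↧-/ i (suc n)) ⟨
  ↥ r ℤ.* (↧ r ℤ.* g)         ≡⟨ x∙yz≈xz∙y (↥ r) (↧ r) g ⟩
  ↥ r ℤ.* g ℤ.* ↧ r           ≡⟨ cong (ℤ._* ↧ r) (ℚP.↥-/ i (suc n)) ⟩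
  i ℤ.* ↧ r                   ≡⟨ cong (i ℤ.*_) (ℚP.↧ᵘ-toℚᵘ r) ⟨
  i ℤ.* ℚᵘ.↧ (toℚᵘ r)         ∎)
  where
  open ≡-Reasoning
  r = i ℚ./ suc n
  g = gcd i (+ suc n)

floor-1/n*m : ∀ m w → floor ((+ 1 ℚ./ suc w) ℚ.* (+ m ℚ./ 1)) ≡ + (m / suc w)
floor-1/n*m m w = floor-≃ _ m w (ℚᵘP.≃-trans (ℚP.toℚᵘ-homo-* (+ 1 ℚ./ suc w) (+ m ℚ./ 1))
  (ℚᵘP.≃-trans (ℚᵘP.*-cong (toℚᵘ-/ (+ 1) w) (toℚᵘ-/ (+ m) 0)) (*≡* 1/n*m≃m/n)))
  where
  1/n*m≃m/n : (+ 1 ℤ.* + m) ℤ.* + suc w ≡ + m ℤ.* + suc (w * 1)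
  1/n*m≃m/n = cong₂ (λ a b → a ℤ.* + suc b) (ℤP.*-identityˡ (+ m)) (sym (*-identityʳ w))

1/-reflects-≥ : ∀ {a b} → + 1 ℚ./ suc a ℚ.≤ + 1 ℚ./ suc b → b ≤ a
1/-reflects-≥ {a} {b} 1/a≤1/b with ℚᵘP.≤-respʳ-≃ (toℚᵘ-/ (+ 1) b)
  (ℚᵘP.≤-respˡ-≃ (toℚᵘ-/ (+ 1) a) (ℚP.toℚᵘ-mono-≤ 1/a≤1/b))
... | *≤* 1*b≤1*a = ≤-pred (ℤP.drop‿+≤+ (subst₂ ℤ._≤_ (ℤP.*-identityˡ (+ suc b)) (ℤP.*-identityˡ (+ suc a)) 1*b≤1*a))

-- ϑ(b) and the largest weight

minList-∈-∷ : ∀ (q : ℚ) qs → minList (q ∷ qs) ∈ q ∷ qs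
minList-∈-∷ q [] = here refl
minList-∈-∷ q (q′ ∷ qs) with ℚP.⊓-sel q (minList (q′ ∷ qs))
... | inj₁ min≡q = here min≡q
... | inj₂ min≡rest = there (subst (_∈ q′ ∷ qs) (sym min≡rest) (minList-∈-∷ q′ qs))

minList-∈ : ∀ {q : ℚ} {qs} → q ∈ qs → minList qs ∈ qs
minList-∈ {qs = q ∷ qs} _ = minList-∈-∷ q qs

minList-≤ : ∀ {q : ℚ} {qs} → q ∈ qs → minList qs ℚ.≤ q
minList-≤ {qs = q ∷ []} (here refl) = ℚP.≤-refl
minList-≤ {qs = q ∷ q′ ∷ qs} (here refl) = ℚP.p⊓q≤p q (minList (q′ ∷ qs))
minList-≤ {qs = q ∷ q′ ∷ qs} (there q∈) = ℚP.≤-trans (ℚP.p⊓q≤q q (minList (q′ ∷ qs))) (minList-≤ q∈)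

∈-primeDivisors⁺ : ∀ {p b} .{{_ : NonZero b}} → Prime p → p ∣ b → p ∈ primeDivisors b
∈-primeDivisors⁺ p-prime p∣b = ∈-filter⁺ (λ p → prime? p ×-dec (p ∣? _)) (∈-upTo⁺ (s≤s (∣⇒≤ p∣b))) (p-prime , p∣b)

∈-primeDivisors⁻ : ∀ {p b} → p ∈ primeDivisors b → Prime p × p ∣ b
∈-primeDivisors⁻ {b = b} p∈ = proj₂ (∈-filter⁻ (λ p → prime? p ×-dec (p ∣? b)) {xs = upTo (suc b)} p∈)

invTerm-suc : ∀ p r {d} → r * (p ∸ 1) ≡ suc d → invTerm p r ≡ + 1 ℚ./ suc d
invTerm-suc p r r*[p-1]≡1+d rewrite r*[p-1]≡1+d = refl

weight-suc : ∀ {b p} .{{_ : NonZero b}} → Prime p → p ∣ b → ∃[ w ] weight b p ≡ suc w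
weight-suc {b} {p} p-prime p∣b with weight b p | weight-nonZero
  where
  weight-nonZero : NonZero (weight b p)
  weight-nonZero = m*n≢0 (val p b) (p ∸ 1) {{>-nonZero (val-≥1 (prime⇒2≤ p-prime) p∣b)}}
                                           {{prime⇒pred-nonZero p-prime}}
... | suc w | _ = w , refl

ϑ-≤ : ∀ {b p w} .{{_ : NonZero b}} → Prime p → p ∣ b → weight b p ≡ suc w → ϑ b ℚ.≤ + 1 ℚ./ suc w
ϑ-≤ {b} {p} p-prime p∣b weight≡1+w =
  subst (ϑ b ℚ.≤_) (invTerm-suc p (val p b) weight≡1+w)
        (minList-≤ (∈-map⁺ (λ q → invTerm q (val q b)) (∈-primeDivisors⁺ p-prime p∣b)))

ϑ-attained : ∀ {b} → 2 ≤ b → ∃[ p ] Prime p × p ∣ b × ϑ b ≡ invTerm p (val p b)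
ϑ-attained {b} 2≤b with ∃-prime-∣ 2≤b
... | p , p-prime , p∣b with ∈-map⁻ invTerm-b (minList-∈ (∈-map⁺ invTerm-b p∈))
  where
  invTerm-b : ℕ → ℚ
  invTerm-b q = invTerm q (val q b)
  instance nonZero-b : NonZero b
  nonZero-b = 2≤⇒nonZero 2≤b
  p∈ : p ∈ primeDivisors b
  p∈ = ∈-primeDivisors⁺ p-prime p∣b
... | q , q∈ , ϑ≡ with ∈-primeDivisors⁻ q∈
... | q-prime , q∣b = q , q-prime , q∣b , ϑ≡

MaxWeight : ℕ → ℕ → Set
MaxWeight b W = (∃[ p ] Prime p × weight b p ≡ W) × (∀ {p} → Prime p → weight b p ≤ W)

ϑ≡1/max-weight : ∀ {b} → 2 ≤ b → ∃[ w ] ϑ b ≡ + 1 ℚ./ suc w × MaxWeight b (suc w)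
ϑ≡1/max-weight {b} 2≤b = from-attained (ϑ-attained 2≤b)
  where
  instance nonZero-b : NonZero b
  nonZero-b = 2≤⇒nonZero 2≤b
  from-attained : ∃[ p ] Prime p × p ∣ b × ϑ b ≡ invTerm p (val p b) →
                  ∃[ w ] ϑ b ≡ + 1 ℚ./ suc w × MaxWeight b (suc w)
  from-attained (p₀ , p₀-prime , p₀∣b , ϑ≡) with weight-suc p₀-prime p₀∣b
  ... | w , weight≡1+w = w , ϑ≡1/[1+w] , (p₀ , p₀-prime , weight≡1+w) , weight≤
    where
    ϑ≡1/[1+w] : ϑ b ≡ + 1 ℚ./ suc w
    ϑ≡1/[1+w] = trans ϑ≡ (invTerm-suc p₀ (val p₀ b) weight≡1+w)
    weight≤ : ∀ {p} → Prime p → weight b p ≤ suc w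
    weight≤ {p} p-prime with p ∣? b
    ... | no p∤b rewrite val-≡0 (prime⇒2≤ p-prime) p∤b = z≤n
    ... | yes p∣b with weight-suc p-prime p∣b
    ...   | w′ , weight≡1+w′ rewrite weight≡1+w′ =
      s≤s (1/-reflects-≥ (subst (ℚ._≤ + 1 ℚ./ suc w′) ϑ≡1/[1+w] (ϑ-≤ p-prime p∣b weight≡1+w′)))

α-bounded : ∀ {b k} → 2 ≤ b → 1 ≤ k → + 0 ℤ.≤ α b k × ∣ α b k ∣ ≤ b * k
α-bounded {b} {k} 2≤b 1≤k = from-max-weight (ϑ≡1/max-weight 2≤b)
  where
  m = b ^ k
  from-max-weight : ∃[ w ] ϑ b ≡ + 1 ℚ./ suc w × MaxWeight b (suc w) →
                    + 0 ℤ.≤ α b k × ∣ α b k ∣ ≤ b * k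
  from-max-weight (w , ϑ≡1/[1+w] , (p₀ , p₀-prime , weight-p₀≡1+w) , weight≤1+w) =
    subst (λ a → + 0 ℤ.≤ a × ∣ a ∣ ≤ b * k) (sym α≡f∸Z) (ℤ.+≤+ z≤n , m≤n+o⇒m∸n≤o f (Z b m) f≤Z+bk)
    where
    open ≡-Reasoning
    f = m / suc w
    Z≤f : Z b m ≤ f
    Z≤f = *≤⇒≤/ (subst (λ W → Z b m * W ≤ m) weight-p₀≡1+w (Z-upper b m p₀-prime))
    f≤Z+bk : f ≤ Z b m + b * k
    f≤Z+bk = Z-lower 2≤b (b^k<2^[b*k] b k {{>-nonZero 1≤k}})
               (λ p-prime → ≤-trans (*-monoʳ-≤ f (weight≤1+w p-prime)) (m/n*n≤m m (suc w)))
    α≡f∸Z : α b k ≡ + (f ∸ Z b m)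
    α≡f∸Z = begin
      floor (ϑ b ℚ.* (+ m ℚ./ 1)) ℤ.- + Z b m              ≡⟨ cong (λ t → floor (t ℚ.* (+ m ℚ./ 1)) ℤ.- + Z b m) ϑ≡1/[1+w] ⟩
      floor ((+ 1 ℚ./ suc w) ℚ.* (+ m ℚ./ 1)) ℤ.- + Z b m  ≡⟨ cong (ℤ._- + Z b m) (floor-1/n*m m w) ⟩
      + f ℤ.- + Z b m                                      ≡⟨ ℤP.m-n≡m⊖n f (Z b m) ⟩
      f ℤ.⊖ Z b m                                          ≡⟨ ℤP.⊖-≥ Z≤f ⟩
      + (f ∸ Z b m)                                        ∎

theorem2 : (b k : ℕ) → 2 ≤ b → 1 ≤ k →
    (+ 0 ℤ.≤ α b k) × (numDigits b ∣ α b k ∣ ≤ floorLog b k + 2)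
theorem2 b k 2≤b 1≤k = map₂ (numDigits-≤ 2≤b) (α-bounded 2≤b 1≤k)
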